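{- For $n\ge1$ and all $k\ge0$, $$P^{+}(n+1,k)=(n-2k)S(n,k),\qquad P^{ - }(n+1,k)=(1+k)S(n,k).$$ Equivalently, $P_{n+1}^+(x)=nS_n(x)-2xS_n'(x)$ and $P_{n+1}^-(x)=S_n(x)+xS_n'(x)$.
   Context: A permutation $\pi\in\mathfrak{S}_n$ is called simsun if for every $k$, the subword of $\pi$ consisting of the letters in $[k]$ (in the order they appear) contains no three consecutive entries $a>b>c$. Let $\mathcal{RS}_n$ be the set of simsun permutations of $[n]$, $\mathcal{RS}_n^+=\{\pi\in\mathcal{RS}_n:\pi(1)>\pi(2)\}$, $\mathcal{RS}_n^-=\{\pi\in\mathcal{RS}_n:\pi(1)<\pi(2)\}$. Let ${\rm des}(\pi)=\#\{i\in[n-1]:\pi(i)>\pi(i+1)\}$, $S(n,k)=\#\{\pi\in\mathcal{RS}_n:{\rm des}(\pi)=k\}$, $S_n(x)=\sum_kS(n,k)x^k$. An interior peak of $\pi$ is an index $i\in\{2,\dots,n-1\}$ with $\pi(i-1)<\pi(i)>\pi(i+1)$, ${\rm pk}(\pi)$ is their number, $P^{\pm}(n,k)=\#\{\pi\in\mathcal{RS}_n^{\pm}:{\rm pk}(\pi)=k\}$ and $P^{\pm}_n(x)=\sum_kP^{\pm}(n,k)x^k$. -}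

module Defs where

open import Data.Nat using (ℕ; zero; suc; _+_; _<ᵇ_; _≤ᵇ_; _≡ᵇ_)
open import Data.Bool using (Bool; true; false; _∧_; _∨_; not; if_then_else_)
open import Data.List using (List; []; _∷_; map; concatMap; filter; length; upTo)

-- Permutations of [n] = {1,...,n} are represented in one-line notation as
-- lists w = π(1) π(2) ... π(n).

words : ℕ → ℕ → List (List ℕ)
words n zero    = [] ∷ []
words n (suc m) = concatMap (λ w → map (λ a → suc a ∷ w) (upTo n)) (words n m)

elemᵇ : ℕ → List ℕ → Bool
elemᵇ a []       = false
elemᵇ a (b ∷ bs) = (a ≡ᵇ b) ∨ elemᵇ a bs

distinctᵇ : List ℕ → Bool
distinctᵇ []       = true
distinctᵇ (a ∷ as) = not (elemᵇ a as) ∧ distinctᵇ as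

perms : ℕ → List (List ℕ)
perms n = Data.List.filter (λ w → Data.Bool.T? (distinctᵇ w)) (words n n)

hasDoubleDescentᵇ : List ℕ → Bool
hasDoubleDescentᵇ (a ∷ b ∷ c ∷ rest) = ((b <ᵇ a) ∧ (c <ᵇ b)) ∨ hasDoubleDescentᵇ (b ∷ c ∷ rest)
hasDoubleDescentᵇ _ = false

restrict : ℕ → List ℕ → List ℕ
restrict k []       = []
restrict k (a ∷ as) = if a ≤ᵇ k then a ∷ restrict k as else restrict k as

-- simsun: for every k (k = 1..n suffices; k = 0 and k > n give the empty word / the whole word)
allᵇ : (ℕ → Bool) → List ℕ → Bool
allᵇ p []       = true
allᵇ p (a ∷ as) = p a ∧ allᵇ p as

simsunᵇ : ℕ → List ℕ → Bool
simsunᵇ n w = allᵇ (λ k → not (hasDoubleDescentᵇ (restrict k w))) (map suc (upTo n))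

des : List ℕ → ℕ
des (a ∷ b ∷ rest) = (if b <ᵇ a then 1 else 0) + des (b ∷ rest)
des _ = 0

pk : List ℕ → ℕ
pk (a ∷ b ∷ c ∷ rest) = (if (a <ᵇ b) ∧ (c <ᵇ b) then 1 else 0) + pk (b ∷ c ∷ rest)
pk _ = 0

startsDownᵇ : List ℕ → Bool
startsDownᵇ (a ∷ b ∷ _) = b <ᵇ a
startsDownᵇ _ = false

startsUpᵇ : List ℕ → Bool
startsUpᵇ (a ∷ b ∷ _) = a <ᵇ b
startsUpᵇ _ = false

countᵇ : (List ℕ → Bool) → List (List ℕ) → ℕ
countᵇ p []       = 0
countᵇ p (w ∷ ws) = (if p w then 1 else 0) + countᵇ p ws

S : ℕ → ℕ → ℕ
S n k = countᵇ (λ w → simsunᵇ n w ∧ (des w ≡ᵇ k)) (perms n)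

P⁺ : ℕ → ℕ → ℕ
P⁺ n k = countᵇ (λ w → simsunᵇ n w ∧ startsDownᵇ w ∧ (pk w ≡ᵇ k)) (perms n)

P⁻ : ℕ → ℕ → ℕ
P⁻ n k = countᵇ (λ w → simsunᵇ n w ∧ startsUpᵇ w ∧ (pk w ≡ᵇ k)) (perms n)

module Submission where

open import Defs

-- Every simsun permutation of [m+1] arises exactly once by inserting m+1 into a simsun
-- permutation σ of [m] at a position that creates no three consecutive descending letters:
-- the restrictions to [k], k ≤ m, do not see the new letter. For m ≥ 2 and σ with p peaks
-- the valid insertions are counted explicitly. If σ starts up, p+1 of them start up with
-- p peaks, m−1−2p start up with p+1 peaks and one (in front) starts down with p peaks; if σ
-- starts down, one starts up with p+1 peaks, p+1 start down with p peaks and m−2−2p start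
-- down with p+1 peaks. Summing over σ expresses P^±(m+1,·) through P^±(m,·), and
-- des σ = pk σ + [σ starts down] gives S(m,q) = P⁻(m,q) + P⁺(m,q−1). Given these
-- recurrences, the theorem at n+1 follows from (n−2q)·P⁻(n+1,q) = (q+1)·P⁺(n+1,q), which in
-- turn follows from the theorem at n.

module SimsunPeaks where
  open import Data.Bool using (Bool; true; false; T; T?; not; _∧_; if_then_else_)
  open import Data.Bool.Properties using (T-∧; T-∨; T-≡; T-not-≡; ∧-zeroʳ; ∧-identityʳ; ∧-assoc; ∨-identityʳ)
  open import Data.Empty using (⊥-elim)
  open import Data.List using (List; []; _∷_; _++_; map; concatMap; filterᵇ; length; upTo)
  open import Data.List.Membership.Propositional using (_∈_; _∉_; find; lose)
  open import Data.List.Membership.Propositional.Properties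
  open import Data.List.Membership.Propositional.Properties.WithK using (unique∧set⇒bag)
  open import Data.List.Properties using (map-++; upTo-∷ʳ; ∷-injectiveˡ; ∷-injectiveʳ)
  open import Data.List.Relation.Binary.BagAndSetEquality using (∼bag⇒↭)
  open import Data.List.Relation.Binary.Permutation.Propositional.Properties using (map⁺)
  open import Data.List.Relation.Unary.All as All using (All; []; _∷_)
  open import Data.List.Relation.Unary.Any using (here; there)
  open import Data.List.Relation.Unary.Unique.Propositional using (Unique; []; _∷_)
  import Data.List.Relation.Unary.Unique.Propositional.Properties as Unique
  open import Data.Nat using (ℕ; zero; suc; _+_; _*_; _≤_; _<_; z≤n; s≤s; _<ᵇ_; _≤ᵇ_; _≡ᵇ_; _≟_; _<?_; pred)
  open import Data.List.Membership.DecPropositional _≟_ using (_∈?_)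
  open import Data.Nat.ListAction using (sum)
  open import Data.Nat.ListAction.Properties using (sum-++; sum-↭)
  open import Data.Nat.Properties
  open import Data.Product using (_×_; _,_; proj₁; proj₂; ∃)
  open import Data.Sum using (_⊎_; inj₁; inj₂; [_,_]′)
  open import Data.Nat.Tactic.RingSolver using (solve-∀)
  open import Function using (_∘′_; id)
  open import Function.Bundles using (mk⇔; Equivalence)
  open import Relation.Binary.PropositionalEquality
  open import Relation.Nullary using (¬_; yes; no)
  open import Relation.Binary.Definitions using (tri<; tri≈; tri>)

  ∑ : {A : Set} → (A → ℕ) → List A → ℕ
  ∑ f xs = sum (map f xs)

  module _ {A : Set} where

    ∑-++ : (f : A → ℕ) (xs ys : List A) → ∑ f (xs ++ ys) ≡ ∑ f xs + ∑ f ys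
    ∑-++ f xs ys = trans (cong sum (map-++ f xs ys)) (sum-++ (map f xs) (map f ys))

    ∑-cong : {f g : A → ℕ} (xs : List A) → (∀ {x} → x ∈ xs → f x ≡ g x) → ∑ f xs ≡ ∑ g xs
    ∑-cong []       f≡g = refl
    ∑-cong (x ∷ xs) f≡g = cong₂ _+_ (f≡g (here refl)) (∑-cong xs (f≡g ∘′ there))

    ∑-+ : (f g : A → ℕ) (xs : List A) → ∑ (λ x → f x + g x) xs ≡ ∑ f xs + ∑ g xs
    ∑-+ f g []       = refl
    ∑-+ f g (x ∷ xs) rewrite ∑-+ f g xs = +-+-comm (f x) (g x) (∑ f xs) (∑ g xs)
      where
      +-+-comm : ∀ a b c d → a + b + (c + d) ≡ a + c + (b + d)
      +-+-comm = solve-∀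

    ∑-*ʳ : (f : A → ℕ) (c : ℕ) (xs : List A) → ∑ (λ x → f x * c) xs ≡ ∑ f xs * c
    ∑-*ʳ f c []       = refl
    ∑-*ʳ f c (x ∷ xs) = trans (cong (f x * c +_) (∑-*ʳ f c xs)) (sym (*-distribʳ-+ c (f x) _))

    ∑-filterᵇ : (f : A → ℕ) (p : A → Bool) (xs : List A) →
                ∑ f (filterᵇ p xs) ≡ ∑ (λ x → if p x then f x else 0) xs
    ∑-filterᵇ f p []       = refl
    ∑-filterᵇ f p (x ∷ xs) with p x
    ... | true  = cong (f x +_) (∑-filterᵇ f p xs)
    ... | false = ∑-filterᵇ f p xs

    ∑-zero : (f : A → ℕ) (xs : List A) → (∀ x → f x ≡ 0) → ∑ f xs ≡ 0
    ∑-zero f []       f≡0 = refl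
    ∑-zero f (x ∷ xs) f≡0 rewrite f≡0 x = ∑-zero f xs f≡0

    ∑-unique-set : (f : A → ℕ) {xs ys : List A} → Unique xs → Unique ys →
                   (∀ {x} → x ∈ xs → x ∈ ys) → (∀ {x} → x ∈ ys → x ∈ xs) → ∑ f xs ≡ ∑ f ys
    ∑-unique-set f xs! ys! xs⊆ys ys⊆xs =
      sum-↭ (map⁺ f (∼bag⇒↭ (unique∧set⇒bag xs! ys! (mk⇔ xs⊆ys ys⊆xs))))

  ∑-map : {A B : Set} (f : B → ℕ) (g : A → B) (xs : List A) → ∑ f (map g xs) ≡ ∑ (λ x → f (g x)) xs
  ∑-map f g []       = refl
  ∑-map f g (x ∷ xs) = cong (f (g x) +_) (∑-map f g xs)

  ∑-concatMap : {A B : Set} (f : B → ℕ) (g : A → List B) (xs : List A) →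
                ∑ f (concatMap g xs) ≡ ∑ (λ x → ∑ f (g x)) xs
  ∑-concatMap f g []       = refl
  ∑-concatMap f g (x ∷ xs) = trans (∑-++ f (g x) (concatMap g xs)) (cong (∑ f (g x) +_) (∑-concatMap f g xs))

  𝟙 : Bool → ℕ
  𝟙 b = if b then 1 else 0

  countᵇ≡∑ : (p : List ℕ → Bool) (ws : List (List ℕ)) → countᵇ p ws ≡ ∑ (λ w → 𝟙 (p w)) ws
  countᵇ≡∑ p []       = refl
  countᵇ≡∑ p (w ∷ ws) = cong (𝟙 (p w) +_) (countᵇ≡∑ p ws)

  module _ {A B : Set} (g : A → List B) where

    ∈-concatMap-∃ : ∀ {xs v} → v ∈ concatMap g xs → ∃ λ x → x ∈ xs × v ∈ g x
    ∈-concatMap-∃ v∈ = find (∈-concatMap⁻ g v∈)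

    ∈-concatMap-intro : ∀ {xs x v} → x ∈ xs → v ∈ g x → v ∈ concatMap g xs
    ∈-concatMap-intro x∈ v∈ = ∈-concatMap⁺ g (lose x∈ v∈)

    Unique-concatMap : ∀ {xs} → Unique xs → (∀ {x} → x ∈ xs → Unique (g x)) →
                       (∀ {x y v} → x ∈ xs → y ∈ xs → v ∈ g x → v ∈ g y → x ≡ y) →
                       Unique (concatMap g xs)
    Unique-concatMap {[]}     _        _       _        = []
    Unique-concatMap {x ∷ xs} (x∉ ∷ xs!) g-unique g-disjoint =
      Unique.++⁺ (g-unique (here refl))
                 (Unique-concatMap xs! (g-unique ∘′ there) (λ x∈ y∈ → g-disjoint (there x∈) (there y∈)))
                 disjoint
      where
      disjoint : ∀ {v} → ¬ (v ∈ g x × v ∈ concatMap g xs)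
      disjoint (v∈gx , v∈rest) with ∈-concatMap-∃ v∈rest
      ... | y , y∈xs , v∈gy with g-disjoint (here refl) (there y∈xs) v∈gx v∈gy
      ... | refl = All.lookup x∉ y∈xs refl

  T-not⇒¬T : ∀ {b} → T (not b) → ¬ T b
  T-not⇒¬T {false} _ ()

  ¬T⇒T-not : ∀ {b} → ¬ T b → T (not b)
  ¬T⇒T-not {false} _   = _
  ¬T⇒T-not {true}  ¬tt = ¬tt _

  <⇒<ᵇ≡true : ∀ {a b} → a < b → (a <ᵇ b) ≡ true
  <⇒<ᵇ≡true a<b = Equivalence.to T-≡ (<⇒<ᵇ a<b)

  ≮⇒<ᵇ≡false : ∀ {a b} → ¬ a < b → (a <ᵇ b) ≡ false
  ≮⇒<ᵇ≡false {a} {b} a≮b with a <ᵇ b in eq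
  ... | false = refl
  ... | true  = ⊥-elim (a≮b (<ᵇ⇒< a b (Equivalence.from T-≡ eq)))

  ≢⇒≡ᵇ≡false : ∀ {a b} → a ≢ b → (a ≡ᵇ b) ≡ false
  ≢⇒≡ᵇ≡false {a} {b} a≢b with a ≡ᵇ b in eq
  ... | false = refl
  ... | true  = ⊥-elim (a≢b (≡ᵇ⇒≡ a b (Equivalence.from T-≡ eq)))

  >ᵇ≡not-<ᵇ : ∀ {x y} → x ≢ y → (y <ᵇ x) ≡ not (x <ᵇ y)
  >ᵇ≡not-<ᵇ {x} {y} x≢y with <-cmp x y
  ... | tri< x<y _ _ rewrite <⇒<ᵇ≡true x<y = ≮⇒<ᵇ≡false (<-asym x<y)
  ... | tri≈ _ x≡y _ = ⊥-elim (x≢y x≡y)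
  ... | tri> _ _ y<x rewrite ≮⇒<ᵇ≡false (<-asym y<x) = <⇒<ᵇ≡true y<x

  ≡ᵇ-refl : ∀ a → (a ≡ᵇ a) ≡ true
  ≡ᵇ-refl a = Equivalence.to T-≡ (≡⇒≡ᵇ a a refl)

  InRange : ℕ → ℕ → Set
  InRange n a = 1 ≤ a × a ≤ n

  words-∈⁻ : ∀ n m {w} → w ∈ words n m → length w ≡ m × All (InRange n) w
  words-∈⁻ n zero    (here refl) = refl , []
  words-∈⁻ n (suc m) w∈ with ∈-concatMap-∃ (λ w → map (λ a → suc a ∷ w) (upTo n)) {words n m} w∈
  ... | w′ , w′∈ , v∈ with ∈-map⁻ (λ a → suc a ∷ w′) v∈
  ... | a , a∈ , refl with words-∈⁻ n m w′∈
  ... | len , range = cong suc len , (s≤s z≤n , ∈-upTo⁻ a∈) ∷ range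

  words-∈⁺ : ∀ n m {w} → length w ≡ m → All (InRange n) w → w ∈ words n m
  words-∈⁺ n zero    {[]}        refl []                  = here refl
  words-∈⁺ n (suc m) {suc a ∷ w} refl ((_ , a<n) ∷ range) =
    ∈-concatMap-intro (λ w → map (λ a → suc a ∷ w) (upTo n))
      (words-∈⁺ n m refl range) (∈-map⁺ (λ a → suc a ∷ w) (∈-upTo⁺ a<n))

  words-unique : ∀ n m → Unique (words n m)
  words-unique n zero    = [] ∷ []
  words-unique n (suc m) =
    Unique-concatMap _ (words-unique n m)
      (λ _ → Unique.map⁺ (λ eq → suc-injective (∷-injectiveˡ eq)) (Unique.upTo⁺ n))
      same-tail
    where
    same-tail : ∀ {w w′ v} → w ∈ words n m → w′ ∈ words n m →
                v ∈ map (λ a → suc a ∷ w) (upTo n) → v ∈ map (λ a → suc a ∷ w′) (upTo n) → w ≡ w′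
    same-tail _ _ v∈ v∈′ with ∈-map⁻ _ v∈ | ∈-map⁻ _ v∈′
    ... | _ , _ , refl | _ , _ , eq = ∷-injectiveʳ eq

  T-elemᵇ⇒∈ : ∀ a as → T (elemᵇ a as) → a ∈ as
  T-elemᵇ⇒∈ a (b ∷ bs) t with Equivalence.to T-∨ t
  ... | inj₁ a≡b  = here (≡ᵇ⇒≡ a b a≡b)
  ... | inj₂ a∈bs = there (T-elemᵇ⇒∈ a bs a∈bs)

  ∈⇒T-elemᵇ : ∀ a as → a ∈ as → T (elemᵇ a as)
  ∈⇒T-elemᵇ a (b ∷ bs) (here refl) = Equivalence.from T-∨ (inj₁ (≡⇒≡ᵇ a a refl))
  ∈⇒T-elemᵇ a (b ∷ bs) (there a∈) = Equivalence.from T-∨ (inj₂ (∈⇒T-elemᵇ a bs a∈))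

  T-distinctᵇ⇒Unique : ∀ w → T (distinctᵇ w) → Unique w
  T-distinctᵇ⇒Unique []       _ = []
  T-distinctᵇ⇒Unique (a ∷ as) t with Equivalence.to (T-∧ {not (elemᵇ a as)}) t
  ... | a∉ , as! =
    All.tabulate (λ b∈ a≡b → T-not⇒¬T a∉ (∈⇒T-elemᵇ a as (subst (_∈ as) (sym a≡b) b∈)))
      ∷ T-distinctᵇ⇒Unique as as!

  Unique⇒T-distinctᵇ : ∀ w → Unique w → T (distinctᵇ w)
  Unique⇒T-distinctᵇ []       _           = _
  Unique⇒T-distinctᵇ (a ∷ as) (a∉ ∷ as!) =
    Equivalence.from T-∧ (¬T⇒T-not (λ t → All.lookup a∉ (T-elemᵇ⇒∈ a as t) refl) , Unique⇒T-distinctᵇ as as!)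

  perms-∈⁻ : ∀ n {w} → w ∈ perms n → length w ≡ n × All (InRange n) w × Unique w
  perms-∈⁻ n {w} w∈ with ∈-filter⁻ (λ w → T? (distinctᵇ w)) w∈
  ... | w∈words , t with words-∈⁻ n n w∈words
  ... | len , range = len , range , T-distinctᵇ⇒Unique w t

  perms-∈⁺ : ∀ n {w} → length w ≡ n → All (InRange n) w → Unique w → w ∈ perms n
  perms-∈⁺ n {w} len range w! =
    ∈-filter⁺ (λ w → T? (distinctᵇ w)) (words-∈⁺ n n len range) (Unique⇒T-distinctᵇ w w!)

  perms-unique : ∀ n → Unique (perms n)
  perms-unique n = Unique.filter⁺ _ (words-unique n n)

  -- Inserting the largest letter

  insertions : ℕ → List ℕ → List (List ℕ)
  insertions M []       = (M ∷ []) ∷ []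
  insertions M (x ∷ xs) = (M ∷ x ∷ xs) ∷ map (x ∷_) (insertions M xs)

  delete : ℕ → List ℕ → List ℕ
  delete M []       = []
  delete M (x ∷ xs) = if x ≡ᵇ M then xs else x ∷ delete M xs

  module _ (M : ℕ) where

    ∈-insertions-cons : ∀ x xs {τ} → τ ∈ insertions M (x ∷ xs) →
                        τ ≡ M ∷ x ∷ xs ⊎ ∃ λ τ′ → τ′ ∈ insertions M xs × τ ≡ x ∷ τ′
    ∈-insertions-cons x xs (here refl) = inj₁ refl
    ∈-insertions-cons x xs (there τ∈) with ∈-map⁻ (x ∷_) τ∈
    ... | τ′ , τ′∈ , refl = inj₂ (τ′ , τ′∈ , refl)

    length-insertions : ∀ σ {τ} → τ ∈ insertions M σ → length τ ≡ suc (length σ)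
    length-insertions []       (here refl) = refl
    length-insertions (x ∷ xs) τ∈ with ∈-insertions-cons x xs τ∈
    ... | inj₁ refl              = refl
    ... | inj₂ (τ′ , τ′∈ , refl) = cong suc (length-insertions xs τ′∈)

    letter-insertions : ∀ σ {τ y} → τ ∈ insertions M σ → y ∈ τ → y ≡ M ⊎ y ∈ σ
    letter-insertions []       (here refl) (here refl) = inj₁ refl
    letter-insertions (x ∷ xs) τ∈ y∈ with ∈-insertions-cons x xs τ∈ | y∈
    ... | inj₁ refl              | here refl = inj₁ refl
    ... | inj₁ refl              | there y∈σ = inj₂ y∈σ
    ... | inj₂ (τ′ , τ′∈ , refl) | here refl = inj₂ (here refl)
    ... | inj₂ (τ′ , τ′∈ , refl) | there y∈τ′ with letter-insertions xs τ′∈ y∈τ′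
    ...   | inj₁ y≡M  = inj₁ y≡M
    ...   | inj₂ y∈xs = inj₂ (there y∈xs)

    All-insertions : ∀ {P : ℕ → Set} σ {τ} → P M → All P σ → τ ∈ insertions M σ → All P τ
    All-insertions σ pM pσ τ∈ =
      All.tabulate λ y∈ → [ (λ { refl → pM }) , All.lookup pσ ]′ (letter-insertions σ τ∈ y∈)

    Unique-insertions : ∀ σ {τ} → M ∉ σ → Unique σ → τ ∈ insertions M σ → Unique τ
    Unique-insertions []       _  _ (here refl) = [] ∷ []
    Unique-insertions (x ∷ xs) M∉ σ! τ∈ with ∈-insertions-cons x xs τ∈ | σ!
    ... | inj₁ refl              | _ = All.tabulate (λ y∈ M≡y → M∉ (subst (_∈ x ∷ xs) (sym M≡y) y∈)) ∷ σ!
    ... | inj₂ (τ′ , τ′∈ , refl) | x∉ ∷ xs! =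
      All.tabulate (λ y∈ x≡y → [ (λ { refl → M∉ (here (sym x≡y)) })
                               , (λ y∈xs → All.lookup x∉ y∈xs x≡y) ]′ (letter-insertions xs τ′∈ y∈))
        ∷ Unique-insertions xs (M∉ ∘′ there) xs! τ′∈

    delete-insertions : ∀ σ {τ} → M ∉ σ → τ ∈ insertions M σ → delete M τ ≡ σ
    delete-insertions []       _  (here refl) rewrite ≡ᵇ-refl M = refl
    delete-insertions (x ∷ xs) M∉ τ∈ with ∈-insertions-cons x xs τ∈
    ... | inj₁ refl rewrite ≡ᵇ-refl M = refl
    ... | inj₂ (τ′ , τ′∈ , refl) rewrite ≢⇒≡ᵇ≡false {x} {M} (λ x≡M → M∉ (here (sym x≡M))) =
      cong (x ∷_) (delete-insertions xs (M∉ ∘′ there) τ′∈)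

    insertions-delete : ∀ τ → M ∈ τ → τ ∈ insertions M (delete M τ)
    insertions-delete (x ∷ xs) M∈ with x ≟ M
    insertions-delete (x ∷ [])     _          | yes refl rewrite ≡ᵇ-refl x = here refl
    insertions-delete (x ∷ y ∷ ys) _          | yes refl rewrite ≡ᵇ-refl x = here refl
    insertions-delete (x ∷ xs)     (here M≡x) | no x≢M = ⊥-elim (x≢M (sym M≡x))
    insertions-delete (x ∷ xs)     (there M∈) | no x≢M rewrite ≢⇒≡ᵇ≡false x≢M =
      there (∈-map⁺ (x ∷_) (insertions-delete xs M∈))

    delete-⊆ : ∀ τ {y} → y ∈ delete M τ → y ∈ τ
    delete-⊆ (x ∷ xs) y∈ with x ≡ᵇ M | y∈
    ... | true  | y∈xs       = there y∈xs
    ... | false | here y≡x   = here y≡x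
    ... | false | there y∈xs = there (delete-⊆ xs y∈xs)

    Unique-delete : ∀ τ → Unique τ → Unique (delete M τ)
    Unique-delete []       τ!         = τ!
    Unique-delete (x ∷ xs) (x∉ ∷ xs!) with x ≡ᵇ M
    ... | true  = xs!
    ... | false = All.tabulate (All.lookup x∉ ∘′ delete-⊆ xs) ∷ Unique-delete xs xs!

    ∉-delete : ∀ τ → Unique τ → M ∈ τ → M ∉ delete M τ
    ∉-delete (x ∷ xs) (x∉ ∷ xs!) M∈ with x ≡ᵇ M in eq | M∈
    ... | true  | _          = λ M∈xs → All.lookup x∉ M∈xs (≡ᵇ⇒≡ x M (Equivalence.from T-≡ eq))
    ... | false | here refl  = ⊥-elim (subst T eq (≡⇒≡ᵇ M M refl))
    ... | false | there M∈xs = λ { (here refl) → All.lookup x∉ M∈xs refl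
                                 ; (there M∈′) → ∉-delete xs xs! M∈xs M∈′ }

    insertions-unique : ∀ σ → All (_< M) σ → Unique (insertions M σ)
    insertions-unique []       _          = [] ∷ []
    insertions-unique (x ∷ xs) (x<M ∷ xs<M) =
      All.tabulate front≢ ∷ Unique.map⁺ ∷-injectiveʳ (insertions-unique xs xs<M)
      where
      front≢ : ∀ {v} → v ∈ map (x ∷_) (insertions M xs) → M ∷ x ∷ xs ≢ v
      front≢ v∈ eq with ∈-map⁻ (x ∷_) v∈
      ... | _ , _ , refl = <⇒≢ x<M (sym (∷-injectiveˡ eq))

    length-delete : ∀ τ → M ∈ τ → length τ ≡ suc (length (delete M τ))
    length-delete τ M∈ = length-insertions (delete M τ) (insertions-delete τ M∈)

  InRange-pred : ∀ {n a} → InRange (suc n) a → a ≢ suc n → InRange n a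
  InRange-pred (1≤a , a≤1+n) a≢1+n = 1≤a , ≤-pred (≤∧≢⇒< a≤1+n a≢1+n)

  pigeonhole : ∀ n w → Unique w → All (InRange n) w → length w ≤ n
  pigeonhole zero    []      _  _                    = z≤n
  pigeonhole zero    (_ ∷ _) _  ((1≤a , a≤0) ∷ _)    = ⊥-elim (<⇒≱ 1≤a a≤0)
  pigeonhole (suc n) w       w! range with suc n ∈? w
  ... | no  n+1∉ = m≤n⇒m≤1+n (pigeonhole n w w! (All.tabulate λ a∈ →
                     InRange-pred (All.lookup range a∈) (λ { refl → n+1∉ a∈ })))
  ... | yes n+1∈ = subst (_≤ suc n) (sym (length-delete (suc n) w n+1∈))
                     (s≤s (pigeonhole n (delete (suc n) w) (Unique-delete (suc n) w w!) (All.tabulate λ a∈ →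
                       InRange-pred (All.lookup range (delete-⊆ (suc n) w a∈))
                                    (λ { refl → ∉-delete (suc n) w w! n+1∈ a∈ }))))

  restrict-insertions : ∀ {k M} σ {τ} → k < M → τ ∈ insertions M σ → restrict k τ ≡ restrict k σ
  restrict-insertions {k} {M} σ k<M τ∈ with M ≤ᵇ k in eq
  ... | true = ⊥-elim (<⇒≱ k<M (≤ᵇ⇒≤ M k (Equivalence.from T-≡ eq)))
  ... | false = go σ τ∈
    where
    go : ∀ σ {τ} → τ ∈ insertions M σ → restrict k τ ≡ restrict k σ
    go []       (here refl) rewrite eq = refl
    go (x ∷ xs) τ∈ with ∈-insertions-cons M x xs τ∈
    ... | inj₁ refl rewrite eq = refl
    ... | inj₂ (τ′ , τ′∈ , refl) with x ≤ᵇ k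
    ...   | true  = cong (x ∷_) (go xs τ′∈)
    ...   | false = go xs τ′∈

  restrict-all : ∀ k w → All (_≤ k) w → restrict k w ≡ w
  restrict-all k []      []           = refl
  restrict-all k (x ∷ w) (x≤k ∷ w≤k) rewrite Equivalence.to T-≡ (≤⇒≤ᵇ x≤k) = cong (x ∷_) (restrict-all k w w≤k)

  allᵇ-++ : ∀ (p : ℕ → Bool) xs ys → allᵇ p (xs ++ ys) ≡ allᵇ p xs ∧ allᵇ p ys
  allᵇ-++ p []       ys = refl
  allᵇ-++ p (x ∷ xs) ys rewrite allᵇ-++ p xs ys = sym (∧-assoc (p x) (allᵇ p xs) (allᵇ p ys))

  allᵇ-cong : ∀ {p q : ℕ → Bool} ks → (∀ {k} → k ∈ ks → p k ≡ q k) → allᵇ p ks ≡ allᵇ q ks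
  allᵇ-cong []       p≡q = refl
  allᵇ-cong (k ∷ ks) p≡q = cong₂ _∧_ (p≡q (here refl)) (allᵇ-cong ks (p≡q ∘′ there))

  simsunᵇ-suc : ∀ m w → simsunᵇ (suc m) w ≡ simsunᵇ m w ∧ not (hasDoubleDescentᵇ (restrict (suc m) w))
  simsunᵇ-suc m w = begin
    allᵇ p (map suc (upTo (suc m)))            ≡⟨ cong (allᵇ p ∘′ map suc) (sym (upTo-∷ʳ m)) ⟩
    allᵇ p (map suc (upTo m ++ m ∷ []))        ≡⟨ cong (allᵇ p) (map-++ suc (upTo m) (m ∷ [])) ⟩
    allᵇ p (map suc (upTo m) ++ suc m ∷ [])    ≡⟨ allᵇ-++ p (map suc (upTo m)) (suc m ∷ []) ⟩
    simsunᵇ m w ∧ (p (suc m) ∧ true)           ≡⟨ cong (simsunᵇ m w ∧_) (∧-identityʳ (p (suc m))) ⟩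
    simsunᵇ m w ∧ p (suc m)                    ∎
    where
    open ≡-Reasoning
    p = λ k → not (hasDoubleDescentᵇ (restrict k w))

  simsunᵇ-insertions : ∀ m σ {τ} → All (_≤ m) σ → τ ∈ insertions (suc m) σ →
                       simsunᵇ (suc m) τ ≡ simsunᵇ m σ ∧ not (hasDoubleDescentᵇ τ)
  simsunᵇ-insertions m σ {τ} σ≤m τ∈ =
    trans (simsunᵇ-suc m τ) (cong₂ (λ b w → b ∧ not (hasDoubleDescentᵇ w)) same-restrictions
                                   (restrict-all (suc m) τ (All-insertions (suc m) σ ≤-refl (All.map m≤n⇒m≤1+n σ≤m) τ∈)))
    where
    same-restrictions : simsunᵇ m τ ≡ simsunᵇ m σ
    same-restrictions = allᵇ-cong (map suc (upTo m)) λ k∈ → case k∈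
      where
      case : ∀ {k} → k ∈ map suc (upTo m) → not (hasDoubleDescentᵇ (restrict k τ)) ≡ not (hasDoubleDescentᵇ (restrict k σ))
      case k∈ with ∈-map⁻ suc k∈
      ... | i , i∈ , refl = cong (not ∘′ hasDoubleDescentᵇ) (restrict-insertions σ (s≤s (∈-upTo⁻ i∈)) τ∈)

  simsuns : ℕ → List (List ℕ)
  simsuns m = filterᵇ (simsunᵇ m) (perms m)

  validInsertions : ℕ → List ℕ → List (List ℕ)
  validInsertions M σ = filterᵇ (not ∘′ hasDoubleDescentᵇ) (insertions M σ)

  module _ (m : ℕ) where

    simsuns-∈⁻ : ∀ {τ} → τ ∈ simsuns m → τ ∈ perms m × T (simsunᵇ m τ)
    simsuns-∈⁻ = ∈-filter⁻ (λ w → T? (simsunᵇ m w))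

    simsuns-∈⁺ : ∀ {τ} → τ ∈ perms m → T (simsunᵇ m τ) → τ ∈ simsuns m
    simsuns-∈⁺ = ∈-filter⁺ (λ w → T? (simsunᵇ m w))

    simsuns-unique : Unique (simsuns m)
    simsuns-unique = Unique.filter⁺ _ (perms-unique m)

    simsuns-below : ∀ {σ} → σ ∈ simsuns m → All (_< suc m) σ
    simsuns-below σ∈ = All.map (s≤s ∘′ proj₂) (proj₁ (proj₂ (perms-∈⁻ m (proj₁ (simsuns-∈⁻ σ∈)))))

  module _ (M : ℕ) (σ : List ℕ) where

    validInsertions-∈⁻ : ∀ {τ} → τ ∈ validInsertions M σ → τ ∈ insertions M σ × T (not (hasDoubleDescentᵇ τ))
    validInsertions-∈⁻ = ∈-filter⁻ (λ w → T? (not (hasDoubleDescentᵇ w)))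

    validInsertions-∈⁺ : ∀ {τ} → τ ∈ insertions M σ → T (not (hasDoubleDescentᵇ τ)) → τ ∈ validInsertions M σ
    validInsertions-∈⁺ = ∈-filter⁺ (λ w → T? (not (hasDoubleDescentᵇ w)))

  module _ (m : ℕ) where

    private
      extensions = concatMap (validInsertions (suc m)) (simsuns m)

      below⇒∉ : ∀ {σ} → All (_< suc m) σ → suc m ∉ σ
      below⇒∉ σ<M M∈ = 1+n≰n (≤-pred (All.lookup σ<M M∈))

    extension-∈-simsuns : ∀ {τ} → τ ∈ extensions → τ ∈ simsuns (suc m)
    extension-∈-simsuns τ∈ with ∈-concatMap-∃ (validInsertions (suc m)) {simsuns m} τ∈
    ... | σ , σ∈ , τ∈V with simsuns-∈⁻ m σ∈ | validInsertions-∈⁻ (suc m) σ τ∈V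
    ... | σ∈perms , σ-simsun | τ∈ins , τ-noDD with perms-∈⁻ m σ∈perms
    ... | len , range , σ! =
      simsuns-∈⁺ (suc m)
        (perms-∈⁺ (suc m) (trans (length-insertions (suc m) σ τ∈ins) (cong suc len))
           (All-insertions (suc m) σ (s≤s z≤n , ≤-refl) (All.map (λ (1≤a , a≤m) → 1≤a , m≤n⇒m≤1+n a≤m) range) τ∈ins)
           (Unique-insertions (suc m) σ (below⇒∉ (simsuns-below m σ∈)) σ! τ∈ins))
        (subst T (sym (simsunᵇ-insertions m σ (All.map proj₂ range) τ∈ins))
           (Equivalence.from T-∧ (σ-simsun , τ-noDD)))

    simsuns-∈-extension : ∀ {τ} → τ ∈ simsuns (suc m) → τ ∈ extensions
    simsuns-∈-extension {τ} τ∈ with simsuns-∈⁻ (suc m) τ∈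
    ... | τ∈perms , τ-simsun with perms-∈⁻ (suc m) τ∈perms
    ... | len , range , τ! =
      ∈-concatMap-intro (validInsertions (suc m)) σ∈ (validInsertions-∈⁺ (suc m) σ τ∈ins (proj₂ split))
      where
      M∈τ : suc m ∈ τ
      M∈τ with suc m ∈? τ
      ... | yes M∈ = M∈
      ... | no  M∉ = ⊥-elim (1+n≰n (subst (_≤ m) len (pigeonhole m τ τ! (All.tabulate λ a∈ →
                       InRange-pred (All.lookup range a∈) (λ { refl → M∉ a∈ })))))
      σ = delete (suc m) τ
      τ∈ins : τ ∈ insertions (suc m) σ
      τ∈ins = insertions-delete (suc m) τ M∈τ
      σ-range : All (InRange m) σ
      σ-range = All.tabulate λ a∈ → InRange-pred (All.lookup range (delete-⊆ (suc m) τ a∈))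
                                                  (λ { refl → ∉-delete (suc m) τ τ! M∈τ a∈ })
      split : T (simsunᵇ m σ) × T (not (hasDoubleDescentᵇ τ))
      split = Equivalence.to T-∧ (subst T (simsunᵇ-insertions m σ (All.map proj₂ σ-range) τ∈ins) τ-simsun)
      σ∈ : σ ∈ simsuns m
      σ∈ = simsuns-∈⁺ m (perms-∈⁺ m (suc-injective (trans (sym (length-insertions (suc m) σ τ∈ins)) len))
                                    σ-range (Unique-delete (suc m) τ τ!))
                        (proj₁ split)

    Unique-extensions : Unique extensions
    Unique-extensions =
      Unique-concatMap (validInsertions (suc m)) (simsuns-unique m)
        (λ {σ} σ∈ → Unique.filter⁺ _ (insertions-unique (suc m) σ (simsuns-below m σ∈)))
        (λ {σ} {σ′} σ∈ σ′∈ τ∈ τ∈′ →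
          trans (sym (delete-insertions (suc m) σ (below⇒∉ (simsuns-below m σ∈)) (proj₁ (validInsertions-∈⁻ (suc m) σ τ∈))))
                (delete-insertions (suc m) σ′ (below⇒∉ (simsuns-below m σ′∈)) (proj₁ (validInsertions-∈⁻ (suc m) σ′ τ∈′))))

    ∑-simsuns-suc : (f : List ℕ → ℕ) → ∑ f (simsuns (suc m)) ≡ ∑ (λ σ → ∑ f (validInsertions (suc m) σ)) (simsuns m)
    ∑-simsuns-suc f =
      trans (∑-unique-set f (simsuns-unique (suc m)) Unique-extensions simsuns-∈-extension extension-∈-simsuns)
            (∑-concatMap f (validInsertions (suc m)) (simsuns m))

  -- Peaks of the valid insertions

  NoDoubleDescent : List ℕ → Set
  NoDoubleDescent w = T (not (hasDoubleDescentᵇ w))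

  Admissible : ℕ → List ℕ → Set
  Admissible M σ = All (_< M) σ × NoDoubleDescent σ × Unique σ

  NoDoubleDescent-tail : ∀ a σ → NoDoubleDescent (a ∷ σ) → NoDoubleDescent σ
  NoDoubleDescent-tail a []          _ = _
  NoDoubleDescent-tail a (b ∷ [])    _ = _
  NoDoubleDescent-tail a (b ∷ c ∷ r) t with (b <ᵇ a) ∧ (c <ᵇ b)
  ... | false = t

  NoDoubleDescent-head : ∀ a b c r → NoDoubleDescent (a ∷ b ∷ c ∷ r) → ((b <ᵇ a) ∧ (c <ᵇ b)) ≡ false
  NoDoubleDescent-head a b c r t with (b <ᵇ a) ∧ (c <ᵇ b)
  ... | false = refl

  adjacent-distinct : ∀ {a b : ℕ} {r} → Unique (a ∷ b ∷ r) → a ≢ b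
  adjacent-distinct (a∉ ∷ _) = All.head a∉

  ascent-before-descent : ∀ x y z zs → NoDoubleDescent (x ∷ y ∷ z ∷ zs) → x ≢ y → z < y → x < y
  ascent-before-descent x y z zs t x≢y z<y = ≤∧≢⇒< (≮⇒≥ y≮x) x≢y
    where
    y≮x : ¬ y < x
    y≮x y<x = subst T (NoDoubleDescent-head x y z zs t) (Equivalence.from T-∧ (<⇒<ᵇ y<x , <⇒<ᵇ z<y))

  Admissible-tail : ∀ {M} a σ → Admissible M (a ∷ σ) → Admissible M σ
  Admissible-tail a σ (_ ∷ σ<M , t , _ ∷ σ!) = σ<M , NoDoubleDescent-tail a σ t , σ!

  descent-then-ascent : ∀ x y ys → NoDoubleDescent (x ∷ y ∷ ys) → y < x → not (startsDownᵇ (y ∷ ys)) ≡ true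
  descent-then-ascent x y []       _ _   = refl
  descent-then-ascent x y (z ∷ zs) t y<x =
    cong not (trans (sym (cong (_∧ (z <ᵇ y)) (<⇒<ᵇ≡true y<x))) (NoDoubleDescent-head x y z zs t))

  front-insertion-valid : ∀ {M} σ → Admissible M σ → not (hasDoubleDescentᵇ (M ∷ σ)) ≡ not (startsDownᵇ σ)
  front-insertion-valid []          _                       = refl
  front-insertion-valid (x ∷ [])    _                       = refl
  front-insertion-valid (x ∷ y ∷ r) (x<M ∷ _ , t , _)
    rewrite <⇒<ᵇ≡true x<M | Equivalence.to T-not-≡ t | ∨-identityʳ (y <ᵇ x) = refl

  module _ {M : ℕ} where

    max<ᵇ≡false : ∀ {a} → a < M → (M <ᵇ a) ≡ false
    max<ᵇ≡false a<M = ≮⇒<ᵇ≡false (<-asym a<M)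

    hasDoubleDescentᵇ-cons-insertion : ∀ x xs {τ} → Admissible M (x ∷ xs) → τ ∈ insertions M xs →
                                       hasDoubleDescentᵇ (x ∷ τ) ≡ hasDoubleDescentᵇ τ
    hasDoubleDescentᵇ-cons-insertion x []       _                     (here refl) = refl
    hasDoubleDescentᵇ-cons-insertion x (y ∷ ys) (x<M ∷ _ , _ , _)     τ∈ with ∈-insertions-cons M y ys τ∈
    ... | inj₁ refl rewrite max<ᵇ≡false x<M = refl
    hasDoubleDescentᵇ-cons-insertion x (y ∷ []) (_ ∷ y<M ∷ _ , _ , _) τ∈
        | inj₂ (_ , here refl , refl) rewrite max<ᵇ≡false y<M | ∧-zeroʳ (y <ᵇ x) = refl
    hasDoubleDescentᵇ-cons-insertion x (y ∷ z ∷ zs) (_ ∷ y<M ∷ _ , t , _) τ∈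
        | inj₂ (τ′ , τ′∈ , refl) with ∈-insertions-cons M z zs τ′∈
    ... | inj₁ refl rewrite max<ᵇ≡false y<M | ∧-zeroʳ (y <ᵇ x) = refl
    ... | inj₂ (_ , _ , refl) rewrite NoDoubleDescent-head x y z zs t = refl

    ∑-validInsertions-cons : ∀ x xs → Admissible M (x ∷ xs) → (f : List ℕ → ℕ) →
      ∑ f (validInsertions M (x ∷ xs))
        ≡ (if not (startsDownᵇ (x ∷ xs)) then f (M ∷ x ∷ xs) else 0) + ∑ (λ τ → f (x ∷ τ)) (validInsertions M xs)
    ∑-validInsertions-cons x xs adm f = begin
      ∑ f (validInsertions M (x ∷ xs))
        ≡⟨ ∑-filterᵇ f valid (insertions M (x ∷ xs)) ⟩
      (if valid (M ∷ x ∷ xs) then f (M ∷ x ∷ xs) else 0) + ∑ (λ τ → if valid τ then f τ else 0) (map (x ∷_) (insertions M xs))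
        ≡⟨ cong₂ _+_ (cong (λ b → if b then f (M ∷ x ∷ xs) else 0) (front-insertion-valid (x ∷ xs) adm))
                     (∑-map (λ τ → if valid τ then f τ else 0) (x ∷_) (insertions M xs)) ⟩
      front + ∑ (λ τ → if valid (x ∷ τ) then f (x ∷ τ) else 0) (insertions M xs)
        ≡⟨ cong (front +_) (∑-cong (insertions M xs) λ {τ} τ∈ →
             cong (λ b → if not b then f (x ∷ τ) else 0) (hasDoubleDescentᵇ-cons-insertion x xs adm τ∈)) ⟩
      front + ∑ (λ τ → if valid τ then f (x ∷ τ) else 0) (insertions M xs)
        ≡⟨ cong (front +_) (sym (∑-filterᵇ (λ τ → f (x ∷ τ)) valid (insertions M xs))) ⟩
      front + ∑ (λ τ → f (x ∷ τ)) (validInsertions M xs) ∎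
      where
      open ≡-Reasoning
      valid = λ τ → not (hasDoubleDescentᵇ τ)
      front = if not (startsDownᵇ (x ∷ xs)) then f (M ∷ x ∷ xs) else 0

    pk-max-cons : ∀ σ → All (_< M) σ → pk (M ∷ σ) ≡ pk σ
    pk-max-cons []          _           = refl
    pk-max-cons (y ∷ [])    _           = refl
    pk-max-cons (y ∷ z ∷ r) (y<M ∷ _) rewrite max<ᵇ≡false y<M = refl

    pk-cons-max : ∀ x y r → x < M → All (_< M) (y ∷ r) → pk (x ∷ M ∷ y ∷ r) ≡ suc (pk (y ∷ r))
    pk-cons-max x y r x<M yr<M@(y<M ∷ _) rewrite <⇒<ᵇ≡true x<M | <⇒<ᵇ≡true y<M =
      cong suc (pk-max-cons (y ∷ r) yr<M)

  pk-cons-descent : ∀ y z zs → z < y → pk (y ∷ z ∷ zs) ≡ pk (z ∷ zs)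
  pk-cons-descent y z []       _   = refl
  pk-cons-descent y z (w ∷ ws) z<y rewrite ≮⇒<ᵇ≡false (<-asym z<y) = refl

  pk-peak : ∀ x y z zs → x < y → z < y → pk (x ∷ y ∷ z ∷ zs) ≡ suc (pk (z ∷ zs))
  pk-peak x y z zs x<y z<y rewrite <⇒<ᵇ≡true x<y | <⇒<ᵇ≡true z<y = cong suc (pk-cons-descent y z zs z<y)

  pk-cons-nonpeak : ∀ x y w τ → ¬ w < y → pk (x ∷ y ∷ w ∷ τ) ≡ pk (y ∷ w ∷ τ)
  pk-cons-nonpeak x y w τ w≮y rewrite ≮⇒<ᵇ≡false w≮y | ∧-zeroʳ (x <ᵇ y) = refl

  tailInsertionWeight : ℕ → ℕ → List ℕ → (ℕ → ℕ) → ℕ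
  tailInsertionWeight M x σ P = ∑ (λ τ → P (pk (x ∷ τ))) (validInsertions M σ)

  module _ {M : ℕ} where

    private
      W = tailInsertionWeight M

    tailInsertionWeight-ascent : ∀ x y z zs P → Admissible M (x ∷ y ∷ z ∷ zs) → y < z →
      W x (y ∷ z ∷ zs) P ≡ P (suc (pk (y ∷ z ∷ zs))) + W y (z ∷ zs) P
    tailInsertionWeight-ascent x y z zs P adm@(x<M ∷ yzzs<M , _) y<z =
      trans (∑-validInsertions-cons y (z ∷ zs) adm-y _) (cong₂ _+_ front rest)
      where
      adm-y = Admissible-tail x (y ∷ z ∷ zs) adm
      front : (if not (z <ᵇ y) then P (pk (x ∷ M ∷ y ∷ z ∷ zs)) else 0) ≡ P (suc (pk (y ∷ z ∷ zs)))
      front = trans (cong (λ b → if not b then P (pk (x ∷ M ∷ y ∷ z ∷ zs)) else 0) (≮⇒<ᵇ≡false (<-asym y<z)))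
                    (cong P (pk-cons-max x y (z ∷ zs) x<M yzzs<M))
      rest : ∑ (λ τ → P (pk (x ∷ y ∷ τ))) (validInsertions M (z ∷ zs)) ≡ W y (z ∷ zs) P
      rest = ∑-cong (validInsertions M (z ∷ zs)) λ τ∈ →
        cong P (head-nonpeak (proj₁ (validInsertions-∈⁻ M (z ∷ zs) τ∈)))
        where
        head-nonpeak : ∀ {τ} → τ ∈ insertions M (z ∷ zs) → pk (x ∷ y ∷ τ) ≡ pk (y ∷ τ)
        head-nonpeak τ∈ with ∈-insertions-cons M z zs τ∈
        ... | inj₁ refl            = pk-cons-nonpeak x y M (z ∷ zs) (<-asym (All.head yzzs<M))
        ... | inj₂ (τ′ , _ , refl) = pk-cons-nonpeak x y z τ′ (<-asym y<z)

    tailInsertionWeight-descent : ∀ x y z zs P → Admissible M (x ∷ y ∷ z ∷ zs) → x < y → z < y →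
      let R = ∑ (λ τ → P (suc (pk (y ∷ z ∷ τ)))) (validInsertions M zs) in
      W x (y ∷ z ∷ zs) P ≡ P (suc (pk (z ∷ zs))) + R × W y (z ∷ zs) (P ∘′ suc) ≡ P (suc (suc (pk (z ∷ zs)))) + R
    tailInsertionWeight-descent x y z zs P adm@(_ ∷ y<M ∷ zzs<M , _) x<y z<y =
      trans (∑-validInsertions-cons y (z ∷ zs) adm-y _)
            (cong₂ _+_ front₁ (trans (∑-validInsertions-cons z zs adm-z _) (cong₂ _+_ front₂ rest)))
      , trans (∑-validInsertions-cons z zs adm-z _) (cong (_+ ∑ (λ τ → P (suc (pk (y ∷ z ∷ τ)))) (validInsertions M zs)) front₃)
      where
      adm-y = Admissible-tail x (y ∷ z ∷ zs) adm
      adm-z = Admissible-tail y (z ∷ zs) adm-y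
      z-ascends : not (startsDownᵇ (z ∷ zs)) ≡ true
      z-ascends = descent-then-ascent y z zs (proj₁ (proj₂ adm-y)) z<y
      front₁ : (if not (z <ᵇ y) then P (pk (x ∷ M ∷ y ∷ z ∷ zs)) else 0) ≡ 0
      front₁ rewrite <⇒<ᵇ≡true z<y = refl
      front₂ : (if not (startsDownᵇ (z ∷ zs)) then P (pk (x ∷ y ∷ M ∷ z ∷ zs)) else 0) ≡ P (suc (pk (z ∷ zs)))
      front₂ rewrite z-ascends | max<ᵇ≡false y<M | ∧-zeroʳ (x <ᵇ y) = cong P (pk-cons-max y z zs y<M zzs<M)
      front₃ : (if not (startsDownᵇ (z ∷ zs)) then P (suc (pk (y ∷ M ∷ z ∷ zs))) else 0) ≡ P (suc (suc (pk (z ∷ zs))))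
      front₃ rewrite z-ascends = cong (P ∘′ suc) (pk-cons-max y z zs y<M zzs<M)
      rest : ∑ (λ τ → P (pk (x ∷ y ∷ z ∷ τ))) (validInsertions M zs) ≡ ∑ (λ τ → P (suc (pk (y ∷ z ∷ τ)))) (validInsertions M zs)
      rest rewrite <⇒<ᵇ≡true x<y | <⇒<ᵇ≡true z<y = refl

    -- Among the valid insertions behind x, p + 1 keep the p = pk (x ∷ σ) peaks and |σ| − 2p
    -- add one; the second count is moved to the left so that nothing is subtracted.
    TailInsertionWeightLaw : ℕ → List ℕ → (ℕ → ℕ) → Set
    TailInsertionWeightLaw x σ P =
      W x σ P + P (suc (pk (x ∷ σ))) * (2 * pk (x ∷ σ)) ≡ P (pk (x ∷ σ)) * suc (pk (x ∷ σ)) + P (suc (pk (x ∷ σ))) * length σ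

    tailInsertionWeight-step : ∀ x y z zs → Admissible M (x ∷ y ∷ z ∷ zs) → (P : ℕ → ℕ) →
      TailInsertionWeightLaw y (z ∷ zs) P → TailInsertionWeightLaw y (z ∷ zs) (P ∘′ suc) →
      TailInsertionWeightLaw x (y ∷ z ∷ zs) P
    tailInsertionWeight-step x y z zs adm@(_ , noDD , xyzzs!) P IH IH-suc with <-cmp y z
    ... | tri≈ _ y≡z _ = ⊥-elim (adjacent-distinct (proj₂ (proj₂ (Admissible-tail x _ adm))) y≡z)
    ... | tri< y<z _ _ rewrite pk-cons-nonpeak x y z zs (<-asym y<z) = begin
      W x (y ∷ z ∷ zs) P + P (suc p) * (2 * p)
        ≡⟨ cong (_+ P (suc p) * (2 * p)) (tailInsertionWeight-ascent x y z zs P adm y<z) ⟩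
      P (suc p) + W y (z ∷ zs) P + P (suc p) * (2 * p)
        ≡⟨ +-assoc (P (suc p)) _ _ ⟩
      P (suc p) + (W y (z ∷ zs) P + P (suc p) * (2 * p))
        ≡⟨ cong (P (suc p) +_) IH ⟩
      P (suc p) + (P p * suc p + P (suc p) * L)
        ≡⟨ arith (P (suc p)) (P p) p L ⟩
      P p * suc p + P (suc p) * suc L ∎
      where
      open ≡-Reasoning
      p = pk (y ∷ z ∷ zs)
      L = length (z ∷ zs)
      arith : ∀ u a p L → u + (a * suc p + u * L) ≡ a * suc p + u * suc L
      arith = solve-∀
    ... | tri> _ _ z<y rewrite pk-peak x y z zs (ascent-before-descent x y z zs noDD (adjacent-distinct xyzzs!) z<y) z<y
                             | pk-cons-descent y z zs z<y = begin
      W x (y ∷ z ∷ zs) P + P (suc (suc p)) * (2 * suc p)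
        ≡⟨ cong (_+ P (suc (suc p)) * (2 * suc p)) (proj₁ unfold) ⟩
      P (suc p) + R + P (suc (suc p)) * (2 * suc p)
        ≡⟨ arith₁ (P (suc p)) (P (suc (suc p))) R p ⟩
      P (suc p) + (P (suc (suc p)) + R + P (suc (suc p)) * (2 * p)) + P (suc (suc p))
        ≡⟨ cong (λ w → P (suc p) + (w + P (suc (suc p)) * (2 * p)) + P (suc (suc p))) (sym (proj₂ unfold)) ⟩
      P (suc p) + (W y (z ∷ zs) (P ∘′ suc) + P (suc (suc p)) * (2 * p)) + P (suc (suc p))
        ≡⟨ cong (λ w → P (suc p) + w + P (suc (suc p))) IH-suc ⟩
      P (suc p) + (P (suc p) * suc p + P (suc (suc p)) * L) + P (suc (suc p))
        ≡⟨ arith₂ (P (suc p)) (P (suc (suc p))) p L ⟩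
      P (suc p) * suc (suc p) + P (suc (suc p)) * suc L ∎
      where
      open ≡-Reasoning
      p = pk (z ∷ zs)
      L = length (z ∷ zs)
      R = ∑ (λ τ → P (suc (pk (y ∷ z ∷ τ)))) (validInsertions M zs)
      unfold = tailInsertionWeight-descent x y z zs P adm (ascent-before-descent x y z zs noDD (adjacent-distinct xyzzs!) z<y) z<y
      arith₁ : ∀ u v R p → u + R + v * (2 * suc p) ≡ u + (v + R + v * (2 * p)) + v
      arith₁ = solve-∀
      arith₂ : ∀ u v p L → u + (u * suc p + v * L) + v ≡ u * suc (suc p) + v * suc L
      arith₂ = solve-∀

    tailInsertionWeight-law : ∀ x σ → Admissible M (x ∷ σ) → (P : ℕ → ℕ) → TailInsertionWeightLaw x σ P
    tailInsertionWeight-law x []           _                   P = arith (P 0) (P 1)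
      where
      arith : ∀ a b → a + 0 + b * 0 ≡ a * 1 + b * 0
      arith = solve-∀
    tailInsertionWeight-law x (y ∷ [])     (x<M ∷ y<M ∷ _ , _) P
      rewrite <⇒<ᵇ≡true x<M | <⇒<ᵇ≡true y<M | max<ᵇ≡false y<M | ∧-zeroʳ (x <ᵇ y) = arith (P 0) (P 1)
      where
      arith : ∀ a b → b + (a + 0) + b * 0 ≡ a * 1 + b * 1
      arith = solve-∀
    tailInsertionWeight-law x (y ∷ z ∷ zs) adm P =
      tailInsertionWeight-step x y z zs adm P (tailInsertionWeight-law y (z ∷ zs) adm-y P)
                                              (tailInsertionWeight-law y (z ∷ zs) adm-y (P ∘′ suc))
      where adm-y = Admissible-tail x (y ∷ z ∷ zs) adm

  insertionProfile : ℕ → List ℕ → (Bool → ℕ → ℕ) → ℕ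
  insertionProfile M σ g = ∑ (λ τ → g (startsUpᵇ τ) (pk τ)) (validInsertions M σ)

  module _ {M : ℕ} (g : Bool → ℕ → ℕ) (x y : ℕ) (ys : List ℕ) (adm : Admissible M (x ∷ y ∷ ys)) where

    private
      p = pk (x ∷ y ∷ ys)
      L = length (y ∷ ys)
      adm-y = Admissible-tail x (y ∷ ys) adm
      x<M = All.head (proj₁ adm)
      yys<M = All.tail (proj₁ adm)

    insertionProfile-ascent : x < y →
      insertionProfile M (x ∷ y ∷ ys) g + g true (suc p) * (2 * p) ≡ g false p + g true p * suc p + g true (suc p) * L
    insertionProfile-ascent x<y = begin
      insertionProfile M (x ∷ y ∷ ys) g + g true (suc p) * (2 * p)
        ≡⟨ cong (_+ g true (suc p) * (2 * p)) (trans (∑-validInsertions-cons x (y ∷ ys) adm _) (cong₂ _+_ front rest)) ⟩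
      g false p + tailInsertionWeight M x (y ∷ ys) (g true) + g true (suc p) * (2 * p)
        ≡⟨ +-assoc (g false p) _ _ ⟩
      g false p + (tailInsertionWeight M x (y ∷ ys) (g true) + g true (suc p) * (2 * p))
        ≡⟨ cong (g false p +_) (tailInsertionWeight-law x (y ∷ ys) adm (g true)) ⟩
      g false p + (g true p * suc p + g true (suc p) * L)
        ≡⟨ +-assoc (g false p) _ _ ⟨
      g false p + g true p * suc p + g true (suc p) * L ∎
      where
      open ≡-Reasoning
      front : (if not (y <ᵇ x) then g (M <ᵇ x) (pk (M ∷ x ∷ y ∷ ys)) else 0) ≡ g false p
      front rewrite ≮⇒<ᵇ≡false (<-asym x<y) | max<ᵇ≡false x<M = refl
      rest : ∑ (λ τ → g (startsUpᵇ (x ∷ τ)) (pk (x ∷ τ))) (validInsertions M (y ∷ ys)) ≡ tailInsertionWeight M x (y ∷ ys) (g true)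
      rest = ∑-cong (validInsertions M (y ∷ ys)) λ {τ} τ∈ →
        cong (λ b → g b (pk (x ∷ τ))) (starts-up (proj₁ (validInsertions-∈⁻ M (y ∷ ys) τ∈)))
        where
        starts-up : ∀ {τ} → τ ∈ insertions M (y ∷ ys) → startsUpᵇ (x ∷ τ) ≡ true
        starts-up τ∈ with ∈-insertions-cons M y ys τ∈
        ... | inj₁ refl            = <⇒<ᵇ≡true x<M
        ... | inj₂ (_ , _ , refl)  = <⇒<ᵇ≡true x<y

    insertionProfile-descent : y < x →
      insertionProfile M (x ∷ y ∷ ys) g + g false (suc p) * suc (2 * p) ≡ g true (suc p) + g false p * suc p + g false (suc p) * L
    insertionProfile-descent y<x rewrite pk-cons-descent x y ys y<x = begin
      insertionProfile M (x ∷ y ∷ ys) g + g false (suc q) * suc (2 * q)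
        ≡⟨ cong (_+ g false (suc q) * suc (2 * q)) unfold ⟩
      g true (suc q) + R + g false (suc q) * suc (2 * q)
        ≡⟨ arith (g true (suc q)) (g false (suc q)) R q ⟩
      g true (suc q) + (g false (suc q) + R + g false (suc q) * (2 * q))
        ≡⟨ cong (λ w → g true (suc q) + (w + g false (suc q) * (2 * q))) (sym unfold-tail) ⟩
      g true (suc q) + (tailInsertionWeight M x (y ∷ ys) (g false) + g false (suc q) * (2 * q))
        ≡⟨ cong (g true (suc q) +_) law ⟩
      g true (suc q) + (g false q * suc q + g false (suc q) * L)
        ≡⟨ +-assoc (g true (suc q)) _ _ ⟨
      g true (suc q) + g false q * suc q + g false (suc q) * L ∎
      where
      open ≡-Reasoning
      q = pk (y ∷ ys)
      R = ∑ (λ τ → g false (pk (x ∷ y ∷ τ))) (validInsertions M ys)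
      y-ascends = descent-then-ascent x y ys (proj₁ (proj₂ adm)) y<x
      law : tailInsertionWeight M x (y ∷ ys) (g false) + g false (suc q) * (2 * q) ≡ g false q * suc q + g false (suc q) * L
      law = subst (λ r → tailInsertionWeight M x (y ∷ ys) (g false) + g false (suc r) * (2 * r) ≡ g false r * suc r + g false (suc r) * L)
                  (pk-cons-descent x y ys y<x) (tailInsertionWeight-law x (y ∷ ys) adm (g false))
      front-after-x : (if not (startsDownᵇ (y ∷ ys)) then g (x <ᵇ M) (pk (x ∷ M ∷ y ∷ ys)) else 0) ≡ g true (suc q)
      front-after-x rewrite y-ascends = cong₂ g (<⇒<ᵇ≡true x<M) (pk-cons-max x y ys x<M yys<M)
      unfold : insertionProfile M (x ∷ y ∷ ys) g ≡ g true (suc q) + R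
      unfold = trans (∑-validInsertions-cons x (y ∷ ys) adm _)
                     (cong₂ _+_ no-front (trans (∑-validInsertions-cons y ys adm-y _)
                                                (cong₂ (λ a b → a + ∑ (λ τ → g b (pk (x ∷ y ∷ τ))) (validInsertions M ys))
                                                       front-after-x (≮⇒<ᵇ≡false (<-asym y<x)))))
        where
        no-front : (if not (y <ᵇ x) then g (M <ᵇ x) (pk (M ∷ x ∷ y ∷ ys)) else 0) ≡ 0
        no-front rewrite <⇒<ᵇ≡true y<x = refl
      unfold-tail : tailInsertionWeight M x (y ∷ ys) (g false) ≡ g false (suc q) + R
      unfold-tail = trans (∑-validInsertions-cons y ys adm-y _) (cong (_+ R) front-tail)
        where
        front-tail : (if not (startsDownᵇ (y ∷ ys)) then g false (pk (x ∷ M ∷ y ∷ ys)) else 0) ≡ g false (suc q)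
        front-tail rewrite y-ascends = cong (g false) (pk-cons-max x y ys x<M yys<M)
      arith : ∀ a v R q → a + R + v * suc (2 * q) ≡ a + (v + R + v * (2 * q))
      arith = solve-∀

  peak-iff-descent : ∀ a b c r → NoDoubleDescent (a ∷ b ∷ c ∷ r) → a ≢ b → ((a <ᵇ b) ∧ (c <ᵇ b)) ≡ (c <ᵇ b)
  peak-iff-descent a b c r t a≢b with c <? b
  ... | no  c≮b rewrite ≮⇒<ᵇ≡false c≮b = ∧-zeroʳ (a <ᵇ b)
  ... | yes c<b = begin
    (a <ᵇ b) ∧ (c <ᵇ b) ≡⟨ cong₂ _∧_ (<⇒<ᵇ≡true (ascent-before-descent a b c r t a≢b c<b)) (<⇒<ᵇ≡true c<b) ⟩
    true                ≡⟨ <⇒<ᵇ≡true c<b ⟨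
    c <ᵇ b              ∎
    where open ≡-Reasoning

  des≡pk+startsDown : ∀ σ → NoDoubleDescent σ → Unique σ → des σ ≡ pk σ + 𝟙 (startsDownᵇ σ)
  des≡pk+startsDown []              _ _                = refl
  des≡pk+startsDown (a ∷ [])        _ _                = refl
  des≡pk+startsDown (a ∷ b ∷ [])    _ _                = +-identityʳ (𝟙 (b <ᵇ a))
  des≡pk+startsDown (a ∷ b ∷ c ∷ r) t σ!@(_ ∷ bcr!) = begin
    𝟙 (b <ᵇ a) + des (b ∷ c ∷ r)
      ≡⟨ cong (𝟙 (b <ᵇ a) +_) (des≡pk+startsDown (b ∷ c ∷ r) (NoDoubleDescent-tail a (b ∷ c ∷ r) t) bcr!) ⟩
    𝟙 (b <ᵇ a) + (pk (b ∷ c ∷ r) + 𝟙 (c <ᵇ b))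
      ≡⟨ arith (𝟙 (b <ᵇ a)) (pk (b ∷ c ∷ r)) (𝟙 (c <ᵇ b)) ⟩
    𝟙 (c <ᵇ b) + pk (b ∷ c ∷ r) + 𝟙 (b <ᵇ a)
      ≡⟨ cong (λ β → 𝟙 β + pk (b ∷ c ∷ r) + 𝟙 (b <ᵇ a)) (sym (peak-iff-descent a b c r t (adjacent-distinct σ!))) ⟩
    𝟙 ((a <ᵇ b) ∧ (c <ᵇ b)) + pk (b ∷ c ∷ r) + 𝟙 (b <ᵇ a) ∎
    where
    open ≡-Reasoning
    arith : ∀ x y z → x + (y + z) ≡ z + y + x
    arith = solve-∀

  -- Counting simsun permutations by first step and peaks

  -- For u = startsUpᵇ σ, indicator id q u j tests j ≡ q on RS⁻ and indicator not q u j on RS⁺.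
  indicator : (Bool → Bool) → ℕ → Bool → ℕ → ℕ
  indicator dir q u j = 𝟙 (dir u ∧ (j ≡ᵇ q))

  -- With stat = suc ∘ pk this counts the words with q − 1 peaks (none when q = 0), which
  -- makes the recurrences below uniform in q.
  simsunCount : ℕ → (Bool → Bool) → (List ℕ → ℕ) → ℕ → ℕ
  simsunCount m dir stat q = ∑ (λ σ → indicator dir q (startsUpᵇ σ) (stat σ)) (simsuns m)

  indicator-weight : ∀ dir q u j (h : ℕ → ℕ) → indicator dir q u j * h j ≡ indicator dir q u j * h q
  indicator-weight dir q u j h with j ≡ᵇ q in j≡ᵇq
  ... | true  = cong (λ k → 𝟙 (dir u ∧ true) * h k) (≡ᵇ⇒≡ j q (Equivalence.from T-≡ j≡ᵇq))
  ... | false rewrite ∧-zeroʳ (dir u) = refl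

  ∑-indicator-weight : ∀ m dir (stat : List ℕ → ℕ) (h : ℕ → ℕ) q →
    ∑ (λ σ → indicator dir q (startsUpᵇ σ) (stat σ) * h (stat σ)) (simsuns m) ≡ simsunCount m dir stat q * h q
  ∑-indicator-weight m dir stat h q =
    trans (∑-cong (simsuns m) λ {σ} _ → indicator-weight dir q (startsUpᵇ σ) (stat σ) h)
          (∑-*ʳ (λ σ → indicator dir q (startsUpᵇ σ) (stat σ)) (h q) (simsuns m))

  simsunCount-suc-zero : ∀ m dir → simsunCount m dir (suc ∘′ pk) 0 ≡ 0
  simsunCount-suc-zero m dir = ∑-zero _ (simsuns m) λ σ → cong 𝟙 (∧-zeroʳ (dir (startsUpᵇ σ)))

  countᵇ-simsun : ∀ m (r : List ℕ → Bool) → countᵇ (λ w → simsunᵇ m w ∧ r w) (perms m) ≡ ∑ (λ w → 𝟙 (r w)) (simsuns m)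
  countᵇ-simsun m r = begin
    countᵇ (λ w → simsunᵇ m w ∧ r w) (perms m)                  ≡⟨ countᵇ≡∑ _ (perms m) ⟩
    ∑ (λ w → 𝟙 (simsunᵇ m w ∧ r w)) (perms m)                  ≡⟨ ∑-cong (perms m) (λ {w} _ → split (simsunᵇ m w) (r w)) ⟩
    ∑ (λ w → if simsunᵇ m w then 𝟙 (r w) else 0) (perms m)     ≡⟨ ∑-filterᵇ (λ w → 𝟙 (r w)) (simsunᵇ m) (perms m) ⟨
    ∑ (λ w → 𝟙 (r w)) (simsuns m)                              ∎
    where
    open ≡-Reasoning
    split : ∀ a b → 𝟙 (a ∧ b) ≡ (if a then 𝟙 b else 0)
    split true  b = refl
    split false b = refl

  simsun-admissible : ∀ m {σ} → σ ∈ simsuns (suc m) → Admissible (suc (suc m)) σ × length σ ≡ suc m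
  simsun-admissible m {σ} σ∈ with simsuns-∈⁻ (suc m) σ∈
  ... | σ∈perms , σ-simsun with perms-∈⁻ (suc m) σ∈perms
  ... | len , range , σ! = (simsuns-below (suc m) σ∈ , noDD , σ!) , len
    where
    noDD : NoDoubleDescent σ
    noDD = subst NoDoubleDescent (restrict-all (suc m) σ (All.map proj₂ range))
             (proj₂ (Equivalence.to (T-∧ {simsunᵇ m σ}) (subst T (simsunᵇ-suc m σ) σ-simsun)))

  UpInsertionLaw DownInsertionLaw : ℕ → ℕ → List ℕ → Bool → ℕ → Set
  UpInsertionLaw M q σ u L =
    insertionProfile M σ (indicator id q) + indicator id q u (suc (pk σ)) * (2 * pk σ)
      ≡ indicator id q u (pk σ) * suc (pk σ) + indicator id q u (suc (pk σ)) * L + indicator not q u (suc (pk σ))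
  DownInsertionLaw M q σ u L =
    insertionProfile M σ (indicator not q) + indicator not q u (suc (pk σ)) * (2 * suc (pk σ))
      ≡ indicator id q u (pk σ) + indicator not q u (pk σ) * suc (pk σ) + indicator not q u (suc (pk σ)) * suc L

  module _ {M : ℕ} (q x y : ℕ) (ys : List ℕ) (adm : Admissible M (x ∷ y ∷ ys)) where

    private
      σ : List ℕ
      σ = x ∷ y ∷ ys
      p L : ℕ
      p = pk σ
      L = length (y ∷ ys)
      up down : Bool → ℕ → ℕ
      up = indicator id q
      down = indicator not q

    up-insertion-law : UpInsertionLaw M q σ (startsUpᵇ σ) L
    up-insertion-law with <-cmp x y
    ... | tri≈ _ x≡y _ = ⊥-elim (adjacent-distinct (proj₂ (proj₂ adm)) x≡y)
    ... | tri< x<y _ _ = subst (λ u → UpInsertionLaw M q σ u L) (sym (<⇒<ᵇ≡true x<y))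
                           (trans (insertionProfile-ascent up x y ys adm x<y) (sym (+-identityʳ _)))
    ... | tri> _ _ y<x = subst (λ u → UpInsertionLaw M q σ u L) (sym (≮⇒<ᵇ≡false (<-asym y<x)))
                           (trans (insertionProfile-descent up x y ys adm y<x) (trans (+-identityʳ _) (+-identityʳ _)))

    down-insertion-law : DownInsertionLaw M q σ (startsUpᵇ σ) L
    down-insertion-law with <-cmp x y
    ... | tri≈ _ x≡y _ = ⊥-elim (adjacent-distinct (proj₂ (proj₂ adm)) x≡y)
    ... | tri< x<y _ _ = subst (λ u → DownInsertionLaw M q σ u L) (sym (<⇒<ᵇ≡true x<y))
                           (insertionProfile-ascent down x y ys adm x<y)
    ... | tri> _ _ y<x = subst (λ u → DownInsertionLaw M q σ u L) (sym (≮⇒<ᵇ≡false (<-asym y<x)))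
                           (add-v {insertionProfile M σ down} {down true (suc p) + down false p * suc p} {down false (suc p)}
                                  (insertionProfile-descent down x y ys adm y<x))
      where
      add-v : ∀ {a b v} → a + v * suc (2 * p) ≡ b + v * L → a + v * (2 * suc p) ≡ b + v * suc L
      add-v {a} {b} {v} eq = begin
        a + v * (2 * suc p)       ≡⟨ arith₁ a v p ⟩
        a + v * suc (2 * p) + v   ≡⟨ cong (_+ v) eq ⟩
        b + v * L + v             ≡⟨ arith₂ b v L ⟩
        b + v * suc L             ∎
        where
        open ≡-Reasoning
        arith₁ : ∀ a v p → a + v * (2 * suc p) ≡ a + v * suc (2 * p) + v
        arith₁ = solve-∀
        arith₂ : ∀ b v L → b + v * L + v ≡ b + v * suc L
        arith₂ = solve-∀

  simsun-elim : ∀ i {σ} → σ ∈ simsuns (suc (suc i)) → (P : List ℕ → Set) →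
    (∀ x y ys → Admissible (suc (suc (suc i))) (x ∷ y ∷ ys) → length (y ∷ ys) ≡ suc i → P (x ∷ y ∷ ys)) → P σ
  simsun-elim i σ∈ P k with simsun-admissible (suc i) σ∈
  simsun-elim i {x ∷ y ∷ ys} σ∈ P k | adm , len = k x y ys adm (suc-injective len)

  module _ (i q : ℕ) where

    private
      m : ℕ
      m = suc (suc i)
      up down : Bool → ℕ → ℕ
      up = indicator id q
      down = indicator not q
      RS = simsuns m

    simsunCount-up-recurrence :
      simsunCount (suc m) id pk q + simsunCount m id (suc ∘′ pk) q * (2 * pred q)
        ≡ simsunCount m id pk q * suc q + simsunCount m id (suc ∘′ pk) q * suc i + simsunCount m not (suc ∘′ pk) q
    simsunCount-up-recurrence = begin
      simsunCount (suc m) id pk q + simsunCount m id (suc ∘′ pk) q * (2 * pred q)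
        ≡⟨ cong₂ _+_ (∑-simsuns-suc m _) (sym (∑-indicator-weight m id (suc ∘′ pk) (λ j → 2 * pred j) q)) ⟩
      ∑ (λ σ → insertionProfile (suc m) σ up) RS + ∑ (λ σ → up (startsUpᵇ σ) (suc (pk σ)) * (2 * pk σ)) RS
        ≡⟨ ∑-+ _ _ RS ⟨
      ∑ (λ σ → insertionProfile (suc m) σ up + up (startsUpᵇ σ) (suc (pk σ)) * (2 * pk σ)) RS
        ≡⟨ ∑-cong RS (λ σ∈ → simsun-elim i σ∈ (λ σ → UpInsertionLaw (suc m) q σ (startsUpᵇ σ) (suc i)) λ x y ys adm len →
             subst (UpInsertionLaw (suc m) q (x ∷ y ∷ ys) (x <ᵇ y)) len (up-insertion-law q x y ys adm)) ⟩
      ∑ (λ σ → up (startsUpᵇ σ) (pk σ) * suc (pk σ) + up (startsUpᵇ σ) (suc (pk σ)) * suc i + down (startsUpᵇ σ) (suc (pk σ))) RS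
        ≡⟨ trans (∑-+ _ _ RS) (cong (_+ simsunCount m not (suc ∘′ pk) q) (∑-+ _ _ RS)) ⟩
      ∑ (λ σ → up (startsUpᵇ σ) (pk σ) * suc (pk σ)) RS + ∑ (λ σ → up (startsUpᵇ σ) (suc (pk σ)) * suc i) RS
        + simsunCount m not (suc ∘′ pk) q
        ≡⟨ cong₂ (λ a b → a + b + simsunCount m not (suc ∘′ pk) q)
                 (∑-indicator-weight m id pk suc q) (∑-indicator-weight m id (suc ∘′ pk) (λ _ → suc i) q) ⟩
      simsunCount m id pk q * suc q + simsunCount m id (suc ∘′ pk) q * suc i + simsunCount m not (suc ∘′ pk) q ∎
      where
      open ≡-Reasoning

    simsunCount-down-recurrence :
      simsunCount (suc m) not pk q + simsunCount m not (suc ∘′ pk) q * (2 * q)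
        ≡ simsunCount m id pk q + simsunCount m not pk q * suc q + simsunCount m not (suc ∘′ pk) q * m
    simsunCount-down-recurrence = begin
      simsunCount (suc m) not pk q + simsunCount m not (suc ∘′ pk) q * (2 * q)
        ≡⟨ cong₂ _+_ (∑-simsuns-suc m _) (sym (∑-indicator-weight m not (suc ∘′ pk) (2 *_) q)) ⟩
      ∑ (λ σ → insertionProfile (suc m) σ down) RS + ∑ (λ σ → down (startsUpᵇ σ) (suc (pk σ)) * (2 * suc (pk σ))) RS
        ≡⟨ ∑-+ _ _ RS ⟨
      ∑ (λ σ → insertionProfile (suc m) σ down + down (startsUpᵇ σ) (suc (pk σ)) * (2 * suc (pk σ))) RS
        ≡⟨ ∑-cong RS (λ σ∈ → simsun-elim i σ∈ (λ σ → DownInsertionLaw (suc m) q σ (startsUpᵇ σ) (suc i)) λ x y ys adm len →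
             subst (DownInsertionLaw (suc m) q (x ∷ y ∷ ys) (x <ᵇ y)) len (down-insertion-law q x y ys adm)) ⟩
      ∑ (λ σ → up (startsUpᵇ σ) (pk σ) + down (startsUpᵇ σ) (pk σ) * suc (pk σ) + down (startsUpᵇ σ) (suc (pk σ)) * m) RS
        ≡⟨ trans (∑-+ _ _ RS) (cong (_+ ∑ (λ σ → down (startsUpᵇ σ) (suc (pk σ)) * m) RS) (∑-+ _ _ RS)) ⟩
      simsunCount m id pk q + ∑ (λ σ → down (startsUpᵇ σ) (pk σ) * suc (pk σ)) RS + ∑ (λ σ → down (startsUpᵇ σ) (suc (pk σ)) * m) RS
        ≡⟨ cong₂ (λ a b → simsunCount m id pk q + a + b)
                 (∑-indicator-weight m not pk suc q) (∑-indicator-weight m not (suc ∘′ pk) (λ _ → m) q) ⟩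
      simsunCount m id pk q + simsunCount m not pk q * suc q + simsunCount m not (suc ∘′ pk) q * m ∎
      where
      open ≡-Reasoning

  startsDownᵇ-simsun : ∀ i {σ} → σ ∈ simsuns (suc (suc i)) → startsDownᵇ σ ≡ not (startsUpᵇ σ)
  startsDownᵇ-simsun i σ∈ = simsun-elim i σ∈ (λ σ → startsDownᵇ σ ≡ not (startsUpᵇ σ)) λ x y ys adm _ →
    >ᵇ≡not-<ᵇ (adjacent-distinct (proj₂ (proj₂ adm)))

  P⁻≡simsunCount : ∀ m q → P⁻ m q ≡ simsunCount m id pk q
  P⁻≡simsunCount m q = countᵇ-simsun m (λ w → startsUpᵇ w ∧ (pk w ≡ᵇ q))

  P⁺≡simsunCount : ∀ i q → P⁺ (suc (suc i)) q ≡ simsunCount (suc (suc i)) not pk q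
  P⁺≡simsunCount i q =
    trans (countᵇ-simsun (suc (suc i)) (λ w → startsDownᵇ w ∧ (pk w ≡ᵇ q)))
          (∑-cong (simsuns (suc (suc i))) λ {σ} σ∈ → cong (λ b → 𝟙 (b ∧ (pk σ ≡ᵇ q))) (startsDownᵇ-simsun i σ∈))

  S≡simsunCount : ∀ i q → S (suc (suc i)) q ≡ simsunCount (suc (suc i)) id pk q + simsunCount (suc (suc i)) not (suc ∘′ pk) q
  S≡simsunCount i q =
    trans (countᵇ-simsun (suc (suc i)) (λ w → des w ≡ᵇ q))
          (trans (∑-cong (simsuns (suc (suc i))) λ {σ} σ∈ →
                    trans (cong (λ d → 𝟙 (d ≡ᵇ q)) (des-simsun σ∈)) (split (startsUpᵇ σ) (pk σ)))
                 (∑-+ _ _ (simsuns (suc (suc i)))))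
    where
    des-simsun : ∀ {σ} → σ ∈ simsuns (suc (suc i)) → des σ ≡ pk σ + 𝟙 (not (startsUpᵇ σ))
    des-simsun {σ} σ∈ with simsun-admissible (suc i) σ∈
    ... | (_ , noDD , σ!) , _ = trans (des≡pk+startsDown σ noDD σ!) (cong (λ b → pk σ + 𝟙 b) (startsDownᵇ-simsun i σ∈))
    split : ∀ u p → 𝟙 ((p + 𝟙 (not u)) ≡ᵇ q) ≡ indicator id q u p + indicator not q u (suc p)
    split true  p rewrite +-identityʳ p = sym (+-identityʳ _)
    split false p rewrite +-comm p 1 = refl

  -- Induction on n

  -- The theorem at n, with its P⁺ half written without subtraction.
  PeakLaw : ℕ → Set
  PeakLaw n = ∀ q → P⁻ (suc n) q ≡ suc q * S n q × P⁺ (suc n) q + 2 * q * S n q ≡ n * S n q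

  -- (n − 2q)·P⁻(n+1,q) = (q+1)·P⁺(n+1,q), written without subtraction.
  Balance : ℕ → Set
  Balance n = ∀ q → simsunCount (suc n) not pk q * suc q + simsunCount (suc n) id pk q * (2 * q)
                      ≡ simsunCount (suc n) id pk q * n

  peakLaw-one : PeakLaw 1
  peakLaw-one zero    = refl , refl
  peakLaw-one (suc k) = sym (*-zeroʳ (suc (suc k))) , *-zeroʳ (2 * suc k)

  balance-from-peakLaw : ∀ i → PeakLaw (suc i) → Balance (suc i)
  balance-from-peakLaw i law q = begin
    D * suc q + U * (2 * q)                 ≡⟨ cong (λ u → D * suc q + u * (2 * q)) up-law ⟩
    D * suc q + suc q * S′ * (2 * q)        ≡⟨ arith₁ D S′ q ⟩
    (D + 2 * q * S′) * suc q                ≡⟨ cong (_* suc q) down-law ⟩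
    suc i * S′ * suc q                      ≡⟨ arith₂ S′ q (suc i) ⟩
    suc q * S′ * suc i                      ≡⟨ cong (_* suc i) up-law ⟨
    U * suc i                               ∎
    where
    open ≡-Reasoning
    U = simsunCount (suc (suc i)) id pk q
    D = simsunCount (suc (suc i)) not pk q
    S′ = S (suc i) q
    up-law : U ≡ suc q * S′
    up-law = trans (sym (P⁻≡simsunCount (suc (suc i)) q)) (proj₁ (law q))
    down-law : D + 2 * q * S′ ≡ suc i * S′
    down-law = trans (cong (_+ 2 * q * S′) (sym (P⁺≡simsunCount i q))) (proj₂ (law q))
    arith₁ : ∀ D S q → D * suc q + suc q * S * (2 * q) ≡ (D + 2 * q * S) * suc q
    arith₁ = solve-∀
    arith₂ : ∀ S q n → n * S * suc q ≡ suc q * S * n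
    arith₂ = solve-∀

  shifted-balance : ∀ i → Balance (suc i) → ∀ q →
    simsunCount (suc (suc i)) not (suc ∘′ pk) q * q + simsunCount (suc (suc i)) id (suc ∘′ pk) q * (2 * pred q)
      ≡ simsunCount (suc (suc i)) id (suc ∘′ pk) q * suc i
  shifted-balance i balance zero
    rewrite simsunCount-suc-zero (suc (suc i)) not | simsunCount-suc-zero (suc (suc i)) id = refl
  shifted-balance i balance (suc k) = balance k

  peakLaw-from-balance : ∀ i → Balance (suc i) → PeakLaw (suc (suc i))
  peakLaw-from-balance i balance q = up-law , down-law
    where
    open ≡-Reasoning
    m = suc (suc i)
    U  = simsunCount m id pk q
    U⁺ = simsunCount m id (suc ∘′ pk) q
    D  = simsunCount m not pk q
    D⁺ = simsunCount m not (suc ∘′ pk) q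
    X  = U⁺ * (2 * pred q)
    S≡ : S m q ≡ U + D⁺
    S≡ = S≡simsunCount i q

    up-law : P⁻ (suc m) q ≡ suc q * S m q
    up-law = begin
      P⁻ (suc m) q                 ≡⟨ P⁻≡simsunCount (suc m) q ⟩
      simsunCount (suc m) id pk q  ≡⟨ +-cancelʳ-≡ X _ _ cancellable ⟩
      (U + D⁺) * suc q             ≡⟨ *-comm (U + D⁺) (suc q) ⟩
      suc q * (U + D⁺)             ≡⟨ cong (suc q *_) S≡ ⟨
      suc q * S m q                ∎
      where
      cancellable : simsunCount (suc m) id pk q + X ≡ (U + D⁺) * suc q + X
      cancellable = begin
        simsunCount (suc m) id pk q + X  ≡⟨ simsunCount-up-recurrence i q ⟩
        U * suc q + U⁺ * suc i + D⁺      ≡⟨ cong (λ t → U * suc q + t + D⁺) (shifted-balance i balance q) ⟨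
        U * suc q + (D⁺ * q + X) + D⁺    ≡⟨ arith U D⁺ X q ⟩
        (U + D⁺) * suc q + X             ∎
        where
        arith : ∀ U D X q → U * suc q + (D * q + X) + D ≡ (U + D) * suc q + X
        arith = solve-∀

    down-law : P⁺ (suc m) q + 2 * q * S m q ≡ m * S m q
    down-law = begin
      P⁺ (suc m) q + 2 * q * S m q              ≡⟨ cong₂ (λ d s → d + 2 * q * s) (P⁺≡simsunCount (suc i) q) S≡ ⟩
      D′ + 2 * q * (U + D⁺)                     ≡⟨ arith₁ D′ U D⁺ q ⟩
      (D′ + D⁺ * (2 * q)) + U * (2 * q)         ≡⟨ cong (_+ U * (2 * q)) (simsunCount-down-recurrence i q) ⟩
      U + D * suc q + D⁺ * m + U * (2 * q)      ≡⟨ arith₂ U D D⁺ q m ⟩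
      U + (D * suc q + U * (2 * q)) + D⁺ * m    ≡⟨ cong (λ t → U + t + D⁺ * m) (balance q) ⟩
      U + U * suc i + D⁺ * m                    ≡⟨ arith₃ U D⁺ i ⟩
      m * (U + D⁺)                              ≡⟨ cong (m *_) S≡ ⟨
      m * S m q                                 ∎
      where
      D′ = simsunCount (suc m) not pk q
      arith₁ : ∀ D′ U D⁺ q → D′ + 2 * q * (U + D⁺) ≡ (D′ + D⁺ * (2 * q)) + U * (2 * q)
      arith₁ = solve-∀
      arith₂ : ∀ U D D⁺ q m → U + D * suc q + D⁺ * m + U * (2 * q) ≡ U + (D * suc q + U * (2 * q)) + D⁺ * m
      arith₂ = solve-∀
      arith₃ : ∀ U D⁺ i → U + U * suc i + D⁺ * suc (suc i) ≡ suc (suc i) * (U + D⁺)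
      arith₃ = solve-∀

  peakLaw : ∀ i → PeakLaw (suc i)
  peakLaw zero    = peakLaw-one
  peakLaw (suc i) = peakLaw-from-balance i (balance-from-peakLaw i (peakLaw i))

open import Data.Integer using (+_; _+_; _-_; _*_)
open import Data.Integer.Properties using (pos-+; pos-*)
open import Data.Integer.Tactic.RingSolver using (solve-∀)
open import Data.Nat using (ℕ; suc; _≥_)
import Data.Nat as ℕ
open import Data.Product using (_×_; _,_; proj₁; proj₂)
open import Relation.Binary.PropositionalEquality using (_≡_; cong; module ≡-Reasoning)
open SimsunPeaks using (peakLaw)

ℕ-difference-to-ℤ : ∀ a b c n → a ℕ.+ b ℕ.* c ≡ n ℕ.* c → + a ≡ (+ n - + b) * + c
ℕ-difference-to-ℤ a b c n eq = begin
  + a                           ≡⟨ arith₁ (+ a) (+ b * + c) ⟩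
  (+ a + + b * + c) - + b * + c ≡⟨ cong (_- + b * + c) from-ℕ ⟩
  + n * + c - + b * + c         ≡⟨ arith₂ (+ n) (+ b) (+ c) ⟩
  (+ n - + b) * + c             ∎
  where
  open ≡-Reasoning
  from-ℕ : + a + + b * + c ≡ + n * + c
  from-ℕ = begin
    + a + + b * + c     ≡⟨ cong (λ t → + a + t) (pos-* b c) ⟨
    + a + + (b ℕ.* c)   ≡⟨ pos-+ a (b ℕ.* c) ⟨
    + (a ℕ.+ b ℕ.* c)   ≡⟨ cong +_ eq ⟩
    + (n ℕ.* c)         ≡⟨ pos-* n c ⟩
    + n * + c           ∎
  arith₁ : ∀ a y → a ≡ (a + y) - y
  arith₁ = solve-∀
  arith₂ : ∀ n b c → n * c - b * c ≡ (n - b) * c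
  arith₂ = solve-∀

mainTheorem4 : (n : ℕ) → n ≥ 1 → (k : ℕ) →
    ((+ P⁺ (suc n) k) ≡ (+ n - + (2 Data.Nat.* k)) * (+ S n k))
      × (P⁻ (suc n) k ≡ (1 Data.Nat.+ k) Data.Nat.* S n k)
mainTheorem4 (suc i) _ k =
  ℕ-difference-to-ℤ (P⁺ (suc (suc i)) k) (2 ℕ.* k) (S (suc i) k) (suc i) (proj₂ (peakLaw i k)) ,
  proj₁ (peakLaw i k)
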